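{- Let $q,a_1$ be integers with $q\geq 2$ and $|a_1|\leq 2\sqrt{q}$. If the pair $q,a_1$ is ordinary and $-a_n=\lfloor 2\sqrt{q}^{\,n}\rfloor$ for some positive integer $n$, then $q$ is not a square and $n$ is odd.
   Context: Let $\sqrt{q}>0$. Let $\alpha\in\mathbb{C}$ be a root of $X^2-a_1X+q$ with $\arg(\alpha)\in[0,\pi]$, let $\bar\alpha$ be its complex conjugate, and for integers $n\geq 0$ set $a_n=\alpha^n+\bar\alpha^n$ (equivalently $a_0=2$, $a_{n+1}=a_1a_n-qa_{n-1}$). Let $\beta=\alpha/\sqrt{q}$. The pair $q,a_1$ is called supersingular if $\beta$ is a root of unity, and ordinary otherwise. -}

module Defs where

open import Data.Nat using (ℕ; zero; suc)
open import Data.Integer using (ℤ; +_; _+_; _-_; _*_; -_; _≤_; _<_; _^_)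
open import Data.Product using (_×_; _,_; ∃-syntax)
open import Data.Sum using (_⊎_)
open import Relation.Binary.PropositionalEquality using (_≡_)

-- The sequence a_n : a_0 = 2, a_1 = a1, a_{n+1} = a1 a_n - q a_{n-1}.
-- (aSeq q a1 n) = (a_n , a_{n+1})
aPair : ℤ → ℤ → ℕ → ℤ × ℤ
aPair q a1 zero = (+ 2 , a1)
aPair q a1 (suc n) with aPair q a1 n
... | (x , y) = (y , a1 * y - q * x)

a : ℤ → ℤ → ℕ → ℤ
a q a1 n with aPair q a1 n
... | (x , _) = x

disc : ℤ → ℤ → ℤ
disc q a1 = a1 * a1 - + 4 * q

-- Complex numbers of the form x + y·t with t = √D := i·√(4q - a1²) ∈ ℂ
-- (t ² = D), represented by the pair (x , y).
-- Multiplication in this (sub)ring of ℂ: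
mulD : ℤ → ℤ × ℤ → ℤ × ℤ → ℤ × ℤ
mulD D (x , y) (u , v) = (x * u + D * (y * v) , x * v + y * u)

powD : ℤ → ℤ × ℤ → ℕ → ℤ × ℤ
powD D z zero = (+ 1 , + 0)
powD D z (suc n) = mulD D z (powD D z n)

-- Equality of the complex numbers x + y√D and x' + y'√D (for D ≤ 0 an integer):
-- the map (x , y) ↦ x + y√D is injective unless D = 0.
EqD : ℤ → ℤ × ℤ → ℤ × ℤ → Set
EqD D (x , y) (x' , y') = x ≡ x' × (D ≡ + 0 ⊎ y ≡ y')

-- 2α = a1 + √D, where α = (a1 + i√(4q - a1²))/2 is the root of X² - a1 X + q
-- with arg α ∈ [0, π].
twoAlpha : ℤ → ℤ × ℤ
twoAlpha a1 = (a1 , + 1)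

-- β = α/√q is a root of unity iff β^m = 1 for some m ≥ 1, iff β^(2k) = 1
-- for some k ≥ 1, iff (2α)^(2k) = (4q)^k for some k ≥ 1.
Supersingular : ℤ → ℤ → Set
Supersingular q a1 =
  ∃[ k ] (1 Data.Nat.≤ k × EqD (disc q a1) (powD (disc q a1) (twoAlpha a1) (2 Data.Nat.* k))
                                  ((+ 4 * q) ^ k , + 0))

Ordinary : ℤ → ℤ → Set
Ordinary q a1 = Supersingular q a1 → Data.Empty.⊥
  where import Data.Empty

-- m = ⌊ 2 √q ^ n ⌋ ; since 2 √q ^ n = √(4 q^n) ≥ 0 this says
-- 0 ≤ m, m² ≤ 4 q^n < (m+1)².
IsFloorTwoSqrtQPow : ℤ → ℕ → ℤ → Set
IsFloorTwoSqrtQPow q n m =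
  + 0 ≤ m × m * m ≤ + 4 * q ^ n × + 4 * q ^ n < (m + + 1) * (m + + 1)

{-# OPTIONS --safe #-}
module Submission where

open import Defs
open import Data.Nat using (ℕ; _%_)
open import Data.Integer using (ℤ; +_; _*_; _≤_; -_)
open import Data.Product using (∃-syntax)
open import Relation.Nullary using (¬_)
open import Relation.Binary.PropositionalEquality using (_≡_)
open import Data.Product using (_×_)

open import Data.Nat as ℕ using (zero; suc)
import Data.Nat.Properties as ℕ
open import Data.Nat.DivMod using (m≡m%n+[m/n]*n; m%n<n; _/_)
open import Data.Integer using (_+_; _-_; _^_; _<_; ∣_∣; -[1+_])
open import Data.Integer.Properties
  using (pos-*; drop‿+≤+; drop‿+<+; i*j≡0⇒i≡0∨j≡0; *-cancelʳ-≡; +-identityʳ; ^-*-assoc; *-identityʳ)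
open import Data.Integer.Tactic.RingSolver using (solve-∀)
open import Data.Product using (_,_; proj₁; proj₂)
open import Data.Sum using (inj₁; inj₂; _⊎_; reduce)
open import Data.Empty using (⊥-elim)
open import Relation.Nullary using (yes; no)
open import Relation.Binary.PropositionalEquality
  using (refl; sym; trans; cong; cong₂; subst; subst₂; _≢_; module ≡-Reasoning)
open ≡-Reasoning

-- If 4qⁿ is a perfect square, which it is when q is a square or n is even, then the floor
-- condition forces aₙ² = 4qⁿ. Now 2ⁿ⁻¹aₙ is the real part of (2α)ⁿ, whose norm is (4q)ⁿ,
-- so (2α)ⁿ is real and (2α)²ⁿ = (4q)ⁿ, i.e. β²ⁿ = 1: the pair would be supersingular.

^-distribʳ-* : ∀ i j n → (i * j) ^ n ≡ i ^ n * j ^ n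
^-distribʳ-* i j zero = refl
^-distribʳ-* i j (suc n) = trans (cong (i * j *_) (^-distribʳ-* i j n)) (swap i j (i ^ n) (j ^ n))
  where
  swap : ∀ x y u v → x * y * (u * v) ≡ x * u * (y * v)
  swap = solve-∀

+∣i∣*+∣i∣≡i*i : ∀ i → + ∣ i ∣ * + ∣ i ∣ ≡ i * i
+∣i∣*+∣i∣≡i*i (+ _) = refl
+∣i∣*+∣i∣≡i*i -[1+ _ ] = refl

^-square-half : ∀ i n → n % 2 ≡ 0 → i ^ (n / 2) * i ^ (n / 2) ≡ i ^ n
^-square-half i n n%2≡0 = begin
  i ^ j * i ^ j  ≡⟨ cong (i ^ j *_) (sym (*-identityʳ (i ^ j))) ⟩
  (i ^ j) ^ 2    ≡⟨ ^-*-assoc i j 2 ⟩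
  i ^ (j ℕ.* 2)  ≡⟨ cong (i ^_) (sym n≡j*2) ⟩
  i ^ n          ∎
  where
  j = n / 2
  n≡j*2 : n ≡ j ℕ.* 2
  n≡j*2 = trans (m≡m%n+[m/n]*n n 2) (cong (ℕ._+ j ℕ.* 2) n%2≡0)

squares-≤-<⇒≡ : ∀ m s → m ℕ.* m ℕ.≤ s ℕ.* s → s ℕ.* s ℕ.< suc m ℕ.* suc m → m ≡ s
squares-≤-<⇒≡ m s m²≤s² s²<[m+1]² = ℕ.≤-antisym m≤s s≤m
  where
  m≤s : m ℕ.≤ s
  m≤s with m ℕ.≤? s
  ... | yes m≤s = m≤s
  ... | no m≰s = let s<m = ℕ.≰⇒> m≰s in ⊥-elim (ℕ.<⇒≱ (ℕ.*-mono-< s<m s<m) m²≤s²)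
  s≤m : s ℕ.≤ m
  s≤m with s ℕ.≤? m
  ... | yes s≤m = s≤m
  ... | no s≰m = let m<s = ℕ.≰⇒> s≰m in ⊥-elim (ℕ.<⇒≱ s²<[m+1]² (ℕ.*-mono-≤ m<s m<s))

n%2≡0⊎n%2≡1 : ∀ n → n % 2 ≡ 0 ⊎ n % 2 ≡ 1
n%2≡0⊎n%2≡1 n with n % 2 | m%n<n n 2
... | 0 | _ = inj₁ refl
... | 1 | _ = inj₂ refl
... | suc (suc _) | ℕ.s≤s (ℕ.s≤s ())

mulD-assoc : ∀ D z w v → mulD D z (mulD D w v) ≡ mulD D (mulD D z w) v
mulD-assoc D (x , y) (u , v) (s , t) = cong₂ _,_ (re-assoc D x y u v s t) (im-assoc D x y u v s t)
  where
  re-assoc : ∀ D x y u v s t → x * (u * s + D * (v * t)) + D * (y * (u * t + v * s))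
                             ≡ (x * u + D * (y * v)) * s + D * ((x * v + y * u) * t)
  re-assoc = solve-∀
  im-assoc : ∀ D x y u v s t → x * (u * t + v * s) + y * (u * s + D * (v * t))
                             ≡ (x * u + D * (y * v)) * t + (x * v + y * u) * s
  im-assoc = solve-∀

mulD-identityˡ : ∀ D z → mulD D (+ 1 , + 0) z ≡ z
mulD-identityˡ D (u , v) = cong₂ _,_ (re-id D u v) (im-id u v)
  where
  re-id : ∀ D u v → + 1 * u + D * (+ 0 * v) ≡ u
  re-id = solve-∀
  im-id : ∀ u v → + 1 * v + + 0 * u ≡ v
  im-id = solve-∀

powD-+ : ∀ D z m n → powD D z (m ℕ.+ n) ≡ mulD D (powD D z m) (powD D z n)
powD-+ D z zero n = sym (mulD-identityˡ D (powD D z n))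
powD-+ D z (suc m) n =
  trans (cong (mulD D z) (powD-+ D z m n)) (mulD-assoc D z (powD D z m) (powD D z n))

normD : ℤ → ℤ × ℤ → ℤ
normD D (x , y) = x * x - D * (y * y)

normD-mulD : ∀ D z w → normD D (mulD D z w) ≡ normD D z * normD D w
normD-mulD D (x , y) (u , v) = brahmagupta D x y u v
  where
  brahmagupta : ∀ D x y u v →
    (x * u + D * (y * v)) * (x * u + D * (y * v)) - D * ((x * v + y * u) * (x * v + y * u))
      ≡ (x * x - D * (y * y)) * (u * u - D * (v * v))
  brahmagupta = solve-∀

normD-powD : ∀ D z n → normD D (powD D z n) ≡ normD D z ^ n
normD-powD D z zero = norm-one D
  where
  norm-one : ∀ D → + 1 * + 1 - D * (+ 0 * + 0) ≡ + 1
  norm-one = solve-∀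
normD-powD D z (suc n) =
  trans (normD-mulD D z (powD D z n)) (cong (normD D z *_) (normD-powD D z n))

mulD-self-real : ∀ D w → proj₁ w * proj₁ w ≡ normD D w → EqD D (mulD D w w) (normD D w , + 0)
mulD-self-real D (x , y) x²≡N = re-eq , im-eq (i*j≡0⇒i≡0∨j≡0 D Dy²≡0)
  where
  Dy²≡0 : D * (y * y) ≡ + 0
  Dy²≡0 = begin
    D * (y * y)                      ≡⟨ difference (x * x) (D * (y * y)) ⟩
    x * x - (x * x - D * (y * y))    ≡⟨ cong (_-_ (x * x)) (sym x²≡N) ⟩
    x * x - x * x                    ≡⟨ cancel (x * x) ⟩
    + 0                              ∎
    where
    difference : ∀ u v → v ≡ u - (u - v)
    difference = solve-∀
    cancel : ∀ u → u - u ≡ + 0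
    cancel = solve-∀
  re-eq : x * x + D * (y * y) ≡ x * x - D * (y * y)
  re-eq = begin
    x * x + D * (y * y)  ≡⟨ cong (_+_ (x * x)) Dy²≡0 ⟩
    x * x + + 0          ≡⟨ +-identityʳ (x * x) ⟩
    x * x                ≡⟨ x²≡N ⟩
    x * x - D * (y * y)  ∎
  im-eq : D ≡ + 0 ⊎ y * y ≡ + 0 → D ≡ + 0 ⊎ x * y + y * x ≡ + 0
  im-eq (inj₁ D≡0) = inj₁ D≡0
  im-eq (inj₂ y²≡0) rewrite reduce (i*j≡0⇒i≡0∨j≡0 y y²≡0) = inj₂ (vanish x)
    where
    vanish : ∀ x → x * + 0 + + 0 * x ≡ + 0
    vanish = solve-∀

powTwoAlpha : ℤ → ℤ → ℕ → ℤ × ℤ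
powTwoAlpha q a1 = powD (disc q a1) (twoAlpha a1)

normD-twoAlpha : ∀ q a1 → normD (disc q a1) (twoAlpha a1) ≡ + 4 * q
normD-twoAlpha q a1 = norm q a1
  where
  norm : ∀ q a1 → a1 * a1 - (a1 * a1 - + 4 * q) * (+ 1 * + 1) ≡ + 4 * q
  norm = solve-∀

-- 2α is a root of X² - 2a₁X + 4q, so its powers satisfy the recurrence of 2ⁿ aₙ.
re-powTwoAlpha-rec : ∀ q a1 n →
  proj₁ (powTwoAlpha q a1 (suc (suc n)))
    ≡ + 2 * a1 * proj₁ (powTwoAlpha q a1 (suc n)) - + 4 * q * proj₁ (powTwoAlpha q a1 n)
re-powTwoAlpha-rec q a1 n = cayley-hamilton q a1 (proj₁ (powTwoAlpha q a1 n)) (proj₂ (powTwoAlpha q a1 n))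
  where
  cayley-hamilton : ∀ q a1 x y →
    a1 * (a1 * x + (a1 * a1 - + 4 * q) * (+ 1 * y)) + (a1 * a1 - + 4 * q) * (+ 1 * (a1 * y + + 1 * x))
      ≡ + 2 * a1 * (a1 * x + (a1 * a1 - + 4 * q) * (+ 1 * y)) - + 4 * q * x
  cayley-hamilton = solve-∀

twice-re-powTwoAlpha : ∀ q a1 n →
  (+ 2 * proj₁ (powTwoAlpha q a1 n) ≡ (+ 2) ^ n * proj₁ (aPair q a1 n)) ×
  (+ 2 * proj₁ (powTwoAlpha q a1 (suc n)) ≡ (+ 2) ^ suc n * proj₂ (aPair q a1 n))
twice-re-powTwoAlpha q a1 zero = refl , base q a1
  where
  base : ∀ q a1 → + 2 * (a1 * + 1 + (a1 * a1 - + 4 * q) * (+ 1 * + 0)) ≡ + 2 * + 1 * a1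
  base = solve-∀
twice-re-powTwoAlpha q a1 (suc n) with aPair q a1 n | twice-re-powTwoAlpha q a1 n
... | (x , y) | (eq₀ , eq₁) = eq₁ , (begin
  + 2 * re (suc (suc n))
    ≡⟨ cong (+ 2 *_) (re-powTwoAlpha-rec q a1 n) ⟩
  + 2 * (+ 2 * a1 * re (suc n) - + 4 * q * re n)
    ≡⟨ distrib q a1 (re (suc n)) (re n) ⟩
  + 2 * a1 * (+ 2 * re (suc n)) - + 4 * q * (+ 2 * re n)
    ≡⟨ cong₂ (λ u v → + 2 * a1 * u - + 4 * q * v) eq₁ eq₀ ⟩
  + 2 * a1 * ((+ 2) ^ suc n * y) - + 4 * q * ((+ 2) ^ n * x)
    ≡⟨ regroup q a1 ((+ 2) ^ n) x y ⟩
  (+ 2) ^ suc (suc n) * (a1 * y - q * x) ∎)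
  where
  re : ℕ → ℤ
  re k = proj₁ (powTwoAlpha q a1 k)
  distrib : ∀ q a1 u v → + 2 * (+ 2 * a1 * u - + 4 * q * v) ≡ + 2 * a1 * (+ 2 * u) - + 4 * q * (+ 2 * v)
  distrib = solve-∀
  regroup : ∀ q a1 p x y → + 2 * a1 * (+ 2 * p * y) - + 4 * q * (p * x) ≡ + 2 * (+ 2 * p) * (a1 * y - q * x)
  regroup = solve-∀

twice-re-powTwoAlpha≡a : ∀ q a1 n → + 2 * proj₁ (powTwoAlpha q a1 n) ≡ (+ 2) ^ n * a q a1 n
twice-re-powTwoAlpha≡a q a1 n with aPair q a1 n | proj₁ (twice-re-powTwoAlpha q a1 n)
... | (_ , _) | eq = eq

a²≡4qⁿ⇒supersingular : ∀ q a1 n → 1 ℕ.≤ n → a q a1 n * a q a1 n ≡ + 4 * q ^ n → Supersingular q a1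
a²≡4qⁿ⇒supersingular q a1 n 1≤n a²≡4qⁿ =
  n , 1≤n , subst (λ k → EqD D (powTwoAlpha q a1 k) ((+ 4 * q) ^ n , + 0)) (sym 2n≡n+n) w²-real
  where
  D = disc q a1
  w = powTwoAlpha q a1 n
  A = a q a1 n
  2n≡n+n : 2 ℕ.* n ≡ n ℕ.+ n
  2n≡n+n = cong (n ℕ.+_) (ℕ.+-identityʳ n)
  N[w]≡ : normD D w ≡ (+ 4 * q) ^ n
  N[w]≡ = trans (normD-powD D (twoAlpha a1) n) (cong (_^ n) (normD-twoAlpha q a1))
  re[w]²≡ : proj₁ w * proj₁ w ≡ (+ 4 * q) ^ n
  re[w]²≡ = *-cancelʳ-≡ _ _ (+ 4) (begin
    proj₁ w * proj₁ w * + 4                  ≡⟨ double (proj₁ w) ⟩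
    (+ 2 * proj₁ w) * (+ 2 * proj₁ w)        ≡⟨ cong (λ u → u * u) (twice-re-powTwoAlpha≡a q a1 n) ⟩
    ((+ 2) ^ n * A) * ((+ 2) ^ n * A)        ≡⟨ regroup ((+ 2) ^ n) A ⟩
    (+ 2) ^ n * (+ 2) ^ n * (A * A)          ≡⟨ cong ((+ 2) ^ n * (+ 2) ^ n *_) a²≡4qⁿ ⟩
    (+ 2) ^ n * (+ 2) ^ n * (+ 4 * q ^ n)    ≡⟨ regroup′ ((+ 2) ^ n * (+ 2) ^ n) (q ^ n) ⟩
    (+ 2) ^ n * (+ 2) ^ n * q ^ n * + 4      ≡⟨ cong (λ u → u * q ^ n * + 4) (sym (^-distribʳ-* (+ 2) (+ 2) n)) ⟩
    (+ 4) ^ n * q ^ n * + 4                  ≡⟨ cong (_* + 4) (sym (^-distribʳ-* (+ 4) q n)) ⟩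
    (+ 4 * q) ^ n * + 4                      ∎)
    where
    double : ∀ x → x * x * + 4 ≡ (+ 2 * x) * (+ 2 * x)
    double = solve-∀
    regroup : ∀ p x → (p * x) * (p * x) ≡ p * p * (x * x)
    regroup = solve-∀
    regroup′ : ∀ u v → u * (+ 4 * v) ≡ u * v * + 4
    regroup′ = solve-∀
  w²-real : EqD D (powTwoAlpha q a1 (n ℕ.+ n)) ((+ 4 * q) ^ n , + 0)
  w²-real rewrite powD-+ D (twoAlpha a1) n n | sym N[w]≡ = mulD-self-real D w (trans re[w]²≡ (sym N[w]≡))

isFloor-of-square : ∀ {q n m} s → IsFloorTwoSqrtQPow q n m → + 4 * q ^ n ≡ + s * + s → m ≡ + s
isFloor-of-square {q} {n} {+ k} s (_ , k²≤4qⁿ , 4qⁿ<[k+1]²) 4qⁿ≡s² =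
  cong +_ (squares-≤-<⇒≡ k s k²≤s² s²<[k+1]²)
  where
  s²≡ : + 4 * q ^ n ≡ + (s ℕ.* s)
  s²≡ = trans 4qⁿ≡s² (sym (pos-* s s))
  [k+1]²≡ : (+ k + + 1) * (+ k + + 1) ≡ + (suc k ℕ.* suc k)
  [k+1]²≡ = trans (cong (λ j → + j * + j) (ℕ.+-comm k 1)) (sym (pos-* (suc k) (suc k)))
  k²≤s² : k ℕ.* k ℕ.≤ s ℕ.* s
  k²≤s² = drop‿+≤+ (subst₂ _≤_ (sym (pos-* k k)) s²≡ k²≤4qⁿ)
  s²<[k+1]² : s ℕ.* s ℕ.< suc k ℕ.* suc k
  s²<[k+1]² = drop‿+<+ (subst₂ _<_ s²≡ [k+1]²≡ 4qⁿ<[k+1]²)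

4qⁿ≡square⇒supersingular : ∀ q a1 n → 1 ℕ.≤ n → IsFloorTwoSqrtQPow q n (- a q a1 n) →
  ∀ t → + 4 * q ^ n ≡ t * t → Supersingular q a1
4qⁿ≡square⇒supersingular q a1 n 1≤n floor t 4qⁿ≡t² = a²≡4qⁿ⇒supersingular q a1 n 1≤n (begin
  a q a1 n * a q a1 n          ≡⟨ neg-square (a q a1 n) ⟩
  - a q a1 n * - a q a1 n      ≡⟨ cong (λ m → m * m) (isFloor-of-square {q} {n} ∣ t ∣ floor 4qⁿ≡∣t∣²) ⟩
  + ∣ t ∣ * + ∣ t ∣            ≡⟨ sym 4qⁿ≡∣t∣² ⟩
  + 4 * q ^ n                  ∎)
  where
  4qⁿ≡∣t∣² : + 4 * q ^ n ≡ + ∣ t ∣ * + ∣ t ∣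
  4qⁿ≡∣t∣² = trans 4qⁿ≡t² (sym (+∣i∣*+∣i∣≡i*i t))
  neg-square : ∀ x → x * x ≡ - x * - x
  neg-square = solve-∀

proposition6 : (q a1 : ℤ) → + 2 ≤ q → a1 * a1 ≤ + 4 * q →
    Ordinary q a1 →
    (n : ℕ) → 1 Data.Nat.≤ n → IsFloorTwoSqrtQPow q n (- a q a1 n) →
    (¬ (∃[ r ] (r * r ≡ q))) × (n % 2 ≡ 1)
proposition6 q a1 _ _ ordinary n 1≤n floor = q-not-square , n-odd
  where
  qⁿ-not-square : ∀ u → u * u ≢ q ^ n
  qⁿ-not-square u u²≡qⁿ = ordinary (4qⁿ≡square⇒supersingular q a1 n 1≤n floor (+ 2 * u)
    (trans (cong (+ 4 *_) (sym u²≡qⁿ)) (quadruple u)))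
    where
    quadruple : ∀ u → + 4 * (u * u) ≡ (+ 2 * u) * (+ 2 * u)
    quadruple = solve-∀
  q-not-square : ¬ (∃[ r ] (r * r ≡ q))
  q-not-square (r , r²≡q) = qⁿ-not-square (r ^ n) (trans (sym (^-distribʳ-* r r n)) (cong (_^ n) r²≡q))
  n-odd : n % 2 ≡ 1
  n-odd with n%2≡0⊎n%2≡1 n
  ... | inj₁ n%2≡0 = ⊥-elim (qⁿ-not-square (q ^ (n / 2)) (^-square-half q n n%2≡0))
  ... | inj₂ n%2≡1 = n%2≡1
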